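{- Let $n\ge3$, $S\subset\mathbb Z_n$ with $0\notin S$ and $|S|\geq 2$, and let $s,t,r\in S$ satisfy $r\equiv s+t\pmod n$. Define \[P^{s,t}:=\sum_{a\in\mathbb Z_n}e_{a,a+s,a+r,a+r+s}.\] Then $P^{s,t}\in\Omega_3(\vec{C}_n^S)$ and $\partial P^{s,t}=W^{s,r}-W^{s,t}$. Consequently $[W^{s,r}]=[W^{s,t}]$ in $H_2^{\mathrm{path}}(\vec{C}_n^S)$.
   Context: GLMY path complex over a field $\mathbb K$ of characteristic $0$: for a finite digraph without loops, elementary paths $e_{v_0\cdots v_m}$ with boundary $\partial e_{v_0\cdots v_m}=\sum_j(-1)^j e_{v_0\cdots\widehat{v_j}\cdots v_m}$, paths with equal consecutive vertices set to zero; $A_m$ is the span of allowed paths (consecutive pairs are arrows); $\Omega_0=A_0$, $\Omega_1=A_1$, $\Omega_m=\{u\in A_m:\partial u\in A_{m-1}\}$; $H_m^{\mathrm{path}}=H_m(\Omega_*,\partial)$. The circulant digraph $\vec{C}_n^S$ has vertex set $\mathbb Z_n$ and arrows $a\to a+s$ for $s\in S$. For $u,v\in S$ and $a\in\mathbb Z_n$, $\operatorname{comm}_a(u,v):=e_{a,a+u,a+u+v}-e_{a,a+v,a+u+v}$ (which is $0$ when $u=v$) and $W^{u,v}:=\sum_{a\in\mathbb Z_n}\operatorname{comm}_a(u,v)$. -}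

module Defs where

open import Level using (Level; _⊔_) renaming (suc to lsuc)
open import Algebra.Bundles using (CommutativeRing; Semiring)
import Algebra.Definitions.RawSemiring as RawSemiringDefs
open import Data.Nat as ℕ using (ℕ; zero; suc)
open import Data.Nat.DivMod using (_%_; m%n<n)
open import Data.Fin as Fin using (Fin; toℕ; fromℕ<; _≟_)
open import Data.Fin.Subset using (Subset; _∈_)
open import Data.Bool using (Bool; true; false; not; _∧_; if_then_else_)
open import Data.List using (List; []; _∷_; allFin; _++_; map; concatMap; length)
open import Data.List.Properties using (≡-dec)
open import Data.Product using (_×_; _,_; ∃; map₁; map₂)
open import Data.Sum using (_⊎_)
open import Relation.Nullary using (¬_; does)
open import Relation.Binary.PropositionalEquality using (_≡_; _≢_)

record Field (c ℓ : Level) : Set (lsuc (c ⊔ ℓ)) where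
  field
    commutativeRing : CommutativeRing c ℓ
  open CommutativeRing commutativeRing public
  open RawSemiringDefs (Semiring.rawSemiring semiring) using () renaming (_×_ to _·ℕ_) public
  field
    0≉1     : ¬ (0# ≈ 1#)
    inverse : ∀ x → ¬ (x ≈ 0#) → ∃ λ y → x * y ≈ 1#

record CharZeroField (c ℓ : Level) : Set (lsuc (c ⊔ ℓ)) where
  field
    field′ : Field c ℓ
  open Field field′ public
  field
    char0 : ∀ m → ¬ ((suc m ·ℕ 1#) ≈ 0#)

infixl 6 _⊕_
_⊕_ : ∀ {n} → Fin n → Fin n → Fin n
_⊕_ {suc m} a b = fromℕ< (m%n<n (toℕ a ℕ.+ toℕ b) (suc m))

Arrow : ∀ {n} → Subset n → Fin n → Fin n → Set
Arrow S a b = ∃ λ s → s ∈ S × b ≡ a ⊕ s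

Allowed : ∀ {n} → Subset n → List (Fin n) → Set
Allowed S []           = Data.Unit.⊤ where import Data.Unit
Allowed S (x ∷ [])     = Data.Unit.⊤ where import Data.Unit
Allowed S (x ∷ y ∷ ys) = Arrow S x y × Allowed S (y ∷ ys)

-- Regular elementary paths: nonempty, no two equal consecutive vertices.
-- Non-regular paths (and the empty path) are identified with 0.
noRep : ∀ {n} → Fin n → List (Fin n) → Bool
noRep x []       = true
noRep x (y ∷ ys) = not (does (x ≟ y)) ∧ noRep y ys

regular : ∀ {n} → List (Fin n) → Bool
regular []       = false
regular (x ∷ xs) = noRep x xs

-- Chains over a field: finite formal K-linear combinations of elementary
-- paths e_{v0⋯vm}, given as lists of (coefficient, path).

module Chains {c ℓ : Level} (K : CharZeroField c ℓ) where
  open CharZeroField K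

  Chain : ℕ → Set c
  Chain n = List (Carrier × List (Fin n))

  e : ∀ {n} → List (Fin n) → Chain n
  e p = (1# , p) ∷ []

  rawCoeff : ∀ {n} → Chain n → List (Fin n) → Carrier
  rawCoeff []             p = 0#
  rawCoeff ((k , q) ∷ cs) p = (if does (≡-dec _≟_ q p) then k else 0#) + rawCoeff cs p

  coeff : ∀ {n} → Chain n → List (Fin n) → Carrier
  coeff u p = if regular p then rawCoeff u p else 0#

  infix 4 _≈ᶜ_
  _≈ᶜ_ : ∀ {n} → Chain n → Chain n → Set ℓ
  u ≈ᶜ v = ∀ p → coeff u p ≈ coeff v p

  infixl 6 _−ᶜ_
  _−ᶜ_ : ∀ {n} → Chain n → Chain n → Chain n
  u −ᶜ v = u ++ map (map₁ (λ k → - k)) v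

  -- k · ∂ e_{x0 x1 ⋯ xm} = Σ_j (-1)^j k e_{x0 ⋯ x̂j ⋯ xm}
  bd : ∀ {n} → Carrier → List (Fin n) → Chain n
  bd k []       = []
  bd k (x ∷ xs) = (k , xs) ∷ map (map₂ (x ∷_)) (bd (- k) xs)

  ∂ : ∀ {n} → Chain n → Chain n
  ∂ []             = []
  ∂ ((k , p) ∷ us) = bd k p ++ ∂ us

  zeroᶜ : ∀ {n} → Chain n
  zeroᶜ = []

  InA : ∀ {n} → Subset n → ℕ → Chain n → Set ℓ
  InA S m u = ∀ p → (length p ≢ suc m ⊎ ¬ Allowed S p) → coeff u p ≈ 0#

  InΩ : ∀ {n} → Subset n → ℕ → Chain n → Set ℓ
  InΩ S m u = InA S m u × InA S (ℕ.pred m) (∂ u)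

  -- [x] = [y] in H_m^path(C_n^S): x, y are m-cycles of Ω_* and x − y is a
  -- boundary of some element of Ω_{m+1}
  SameClass : ∀ {n} → Subset n → ℕ → Chain n → Chain n → Set (c ⊔ ℓ)
  SameClass S m x y =
    InΩ S m x × InΩ S m y × ∂ x ≈ᶜ zeroᶜ × ∂ y ≈ᶜ zeroᶜ ×
    ∃ λ u → InΩ S (suc m) u × ∂ u ≈ᶜ x −ᶜ y

  comm : ∀ {n} → Fin n → Fin n → Fin n → Chain n
  comm a u v = e (a ∷ a ⊕ u ∷ a ⊕ u ⊕ v ∷ []) −ᶜ e (a ∷ a ⊕ v ∷ a ⊕ u ⊕ v ∷ [])

  W : ∀ n → Fin n → Fin n → Chain n
  W n u v = concatMap (λ a → comm a u v) (allFin n)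

  P : ∀ n → Fin n → Fin n → Chain n
  P n s t = concatMap (λ a → e (a ∷ a ⊕ s ∷ a ⊕ (s ⊕ t) ∷ a ⊕ (s ⊕ t) ⊕ s ∷ [])) (allFin n)

-- The four faces of e_{a,a+s,a+r,a+r+s} regroup as comm_a(s,r) plus
-- e_{a+s,a+r,a+r+s} − e_{a,a+s,a+r}, and e_{a+s,a+r,a+r+s} is the translate by s of e_{b,b+t,b+s+t}.
-- Since a sum over ℤ_n is invariant under translation, summing over a gives ∂P^{s,t} = W^{s,r} − W^{s,t}.
-- In the same way ∂ comm_a(u,v) is a sum of two differences between a term and its translate, so ∂W^{u,v} = 0.
-- Every path that occurs is allowed because s, t, r ∈ S.
module Submission where

open import Defs
open import Level using (Level)
open import Data.Nat as ℕ using (ℕ; suc; _≤_)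
import Data.Nat.Properties as ℕₚ
open import Data.Nat.Properties using (m+[n∸m]≡n; <⇒≤)
open import Data.Nat.DivMod using (_%_; m%n<n; %-distribˡ-+; m%n%n≡m%n; [m+n]%n≡m%n; m<n⇒m%n≡m)
open import Data.Fin as Fin using (Fin; toℕ; fromℕ<; _≟_)
open import Data.Fin.Properties using (toℕ-fromℕ<; toℕ-injective; toℕ<n)
open import Data.Fin.Permutation using (Permutation′; permutation)
open import Data.Fin.Subset using (Subset; _∈_; ∣_∣)
open import Data.Bool using (true; false; if_then_else_)
open import Data.List using (List; []; _∷_; allFin; _++_; map; concatMap; length; tabulate)
open import Data.List.Properties using (≡-dec; ++-assoc)
open import Data.List.Relation.Unary.All using (All; []; _∷_; universal) renaming (map to All-map)
open import Data.List.Relation.Unary.All.Properties using (concat⁺; map⁺)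
open import Data.Product using (_×_; _,_; proj₂; map₁)
open import Data.Sum using ([_,_]′)
open import Data.Maybe using (nothing)
open import Data.Unit using (tt)
open import Function using (_∘_)
open import Relation.Nullary using (does; yes; no; contradiction)
open import Relation.Binary.PropositionalEquality as ≡ using (_≡_; _≢_; cong; cong₂)
import Algebra.Properties.Ring as RingProperties
import Algebra.Properties.AbelianGroup as AbelianGroupProperties
import Algebra.Properties.CommutativeMonoid.Sum as CommutativeMonoidSum
import Algebra.Properties.Semiring.Sum as SemiringSum
open import Tactic.RingSolver.Core.AlmostCommutativeRing using (fromCommutativeRing)
import Tactic.RingSolver.NonReflective as RingSolver

module _ {m : ℕ} where
  private
    N = suc m
  open ≡.≡-Reasoning

  toℕ-⊕ : (a b : Fin N) → toℕ (a ⊕ b) ≡ (toℕ a ℕ.+ toℕ b) % N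
  toℕ-⊕ a b = toℕ-fromℕ< _

  %-absorbˡ : ∀ x y → (x % N ℕ.+ y) % N ≡ (x ℕ.+ y) % N
  %-absorbˡ x y = begin
    (x % N ℕ.+ y) % N         ≡⟨ %-distribˡ-+ (x % N) y N ⟩
    (x % N % N ℕ.+ y % N) % N ≡⟨ cong (λ z → (z ℕ.+ y % N) % N) (m%n%n≡m%n x N) ⟩
    (x % N ℕ.+ y % N) % N     ≡⟨ %-distribˡ-+ x y N ⟨
    (x ℕ.+ y) % N             ∎

  %-absorbʳ : ∀ x y → (x ℕ.+ y % N) % N ≡ (x ℕ.+ y) % N
  %-absorbʳ x y = begin
    (x ℕ.+ y % N) % N ≡⟨ cong (_% N) (ℕₚ.+-comm x (y % N)) ⟩
    (y % N ℕ.+ x) % N ≡⟨ %-absorbˡ y x ⟩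
    (y ℕ.+ x) % N     ≡⟨ cong (_% N) (ℕₚ.+-comm y x) ⟩
    (x ℕ.+ y) % N     ∎

  ⊕-comm : (a b : Fin N) → a ⊕ b ≡ b ⊕ a
  ⊕-comm a b = toℕ-injective (begin
    toℕ (a ⊕ b)           ≡⟨ toℕ-⊕ a b ⟩
    (toℕ a ℕ.+ toℕ b) % N ≡⟨ cong (_% N) (ℕₚ.+-comm (toℕ a) (toℕ b)) ⟩
    (toℕ b ℕ.+ toℕ a) % N ≡⟨ toℕ-⊕ b a ⟨
    toℕ (b ⊕ a)           ∎)

  ⊕-assoc : (a b c : Fin N) → a ⊕ b ⊕ c ≡ a ⊕ (b ⊕ c)
  ⊕-assoc a b c = toℕ-injective (begin
    toℕ (a ⊕ b ⊕ c)                       ≡⟨ toℕ-⊕ (a ⊕ b) c ⟩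
    (toℕ (a ⊕ b) ℕ.+ toℕ c) % N          ≡⟨ cong (λ z → (z ℕ.+ toℕ c) % N) (toℕ-⊕ a b) ⟩
    ((toℕ a ℕ.+ toℕ b) % N ℕ.+ toℕ c) % N ≡⟨ %-absorbˡ (toℕ a ℕ.+ toℕ b) (toℕ c) ⟩
    (toℕ a ℕ.+ toℕ b ℕ.+ toℕ c) % N       ≡⟨ cong (_% N) (ℕₚ.+-assoc (toℕ a) (toℕ b) (toℕ c)) ⟩
    (toℕ a ℕ.+ (toℕ b ℕ.+ toℕ c)) % N     ≡⟨ %-absorbʳ (toℕ a) (toℕ b ℕ.+ toℕ c) ⟨
    (toℕ a ℕ.+ (toℕ b ℕ.+ toℕ c) % N) % N ≡⟨ cong (λ z → (toℕ a ℕ.+ z) % N) (toℕ-⊕ b c) ⟨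
    (toℕ a ℕ.+ toℕ (b ⊕ c)) % N          ≡⟨ toℕ-⊕ a (b ⊕ c) ⟨
    toℕ (a ⊕ (b ⊕ c))                     ∎)

  xy⊕z≡xz⊕y : (a b c : Fin N) → a ⊕ b ⊕ c ≡ a ⊕ c ⊕ b
  xy⊕z≡xz⊕y a b c = ≡.trans (⊕-assoc a b c) (≡.trans (cong (a ⊕_) (⊕-comm b c)) (≡.sym (⊕-assoc a c b)))

  ⊖_ : Fin N → Fin N
  ⊖ a = fromℕ< (m%n<n (N ℕ.∸ toℕ a) N)

  xy⊕⊖y≡x : (a s : Fin N) → a ⊕ s ⊕ ⊖ s ≡ a
  xy⊕⊖y≡x a s = toℕ-injective (begin
    toℕ (a ⊕ s ⊕ ⊖ s)                                   ≡⟨ toℕ-⊕ (a ⊕ s) (⊖ s) ⟩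
    (toℕ (a ⊕ s) ℕ.+ toℕ (⊖ s)) % N                    ≡⟨ cong₂ (λ x y → (x ℕ.+ y) % N) (toℕ-⊕ a s) (toℕ-fromℕ< _) ⟩
    ((toℕ a ℕ.+ toℕ s) % N ℕ.+ (N ℕ.∸ toℕ s) % N) % N ≡⟨ %-distribˡ-+ (toℕ a ℕ.+ toℕ s) (N ℕ.∸ toℕ s) N ⟨
    (toℕ a ℕ.+ toℕ s ℕ.+ (N ℕ.∸ toℕ s)) % N           ≡⟨ cong (_% N) (ℕₚ.+-assoc (toℕ a) (toℕ s) _) ⟩
    (toℕ a ℕ.+ (toℕ s ℕ.+ (N ℕ.∸ toℕ s))) % N         ≡⟨ cong (λ z → (toℕ a ℕ.+ z) % N) (m+[n∸m]≡n (<⇒≤ (toℕ<n s))) ⟩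
    (toℕ a ℕ.+ N) % N                                  ≡⟨ [m+n]%n≡m%n (toℕ a) N ⟩
    toℕ a % N                                          ≡⟨ m<n⇒m%n≡m (toℕ<n a) ⟩
    toℕ a                                              ∎)

  translation : Fin N → Permutation′ N
  translation s = permutation (_⊕ s) (_⊕ ⊖ s) cancelˡ (λ a → xy⊕⊖y≡x a s)
    where
    cancelˡ : ∀ a → a ⊕ ⊖ s ⊕ s ≡ a
    cancelˡ a = ≡.trans (xy⊕z≡xz⊕y a (⊖ s) s) (xy⊕⊖y≡x a s)

All-concatMap : ∀ {a b p} {A : Set a} {B : Set b} {P : B → Set p} (f : A → List B) (xs : List A) →
                (∀ x → All P (f x)) → All P (concatMap f xs)
All-concatMap f xs h = concat⁺ (map⁺ (universal h xs))

module PathChains {c ℓ : Level} (K : CharZeroField c ℓ) where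
  open CharZeroField K
  open Chains K
  open CommutativeMonoidSum +-commutativeMonoid using (sum; ∑-distrib-+; sum-permute; sum-cong-≋)
  open SemiringSum semiring using (*-distribˡ-sum)
  open RingSolver (fromCommutativeRing commutativeRing (λ _ → nothing))
    using (solve; _⊜_) renaming (_⊕_ to _:+_; ⊝_ to :-_)
  open RingProperties ring using (-0#≈0#; -‿involutive; -1*x≈-x)
  open AbelianGroupProperties +-abelianGroup using (⁻¹-∙-comm; ⁻¹-anti-homo‿-)
  open import Relation.Binary.Reasoning.Setoid setoid

  δ : ∀ {n} → List (Fin n) → List (Fin n) → Carrier
  δ q p = if does (≡-dec _≟_ q p) then 1# else 0#

  if-neg : ∀ b {k} → (if b then - k else 0#) ≈ - (if b then k else 0#)
  if-neg true  = refl
  if-neg false = sym -0#≈0#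

  if-cong : ∀ b {k k′} → k ≈ k′ → (if b then k else 0#) ≈ (if b then k′ else 0#)
  if-cong true  k≈k′ = k≈k′
  if-cong false _    = refl

  if-neg² : ∀ b → (if b then - (- 1#) else 0#) ≈ (if b then 1# else 0#)
  if-neg² b = if-cong b (-‿involutive 1#)

  if-neg³ : ∀ b → (if b then - (- (- 1#)) else 0#) ≈ - (if b then 1# else 0#)
  if-neg³ b = trans (if-cong b (-‿involutive (- 1#))) (if-neg b)

  rawCoeff-++ : ∀ {n} (u v : Chain n) p → rawCoeff (u ++ v) p ≈ rawCoeff u p + rawCoeff v p
  rawCoeff-++ []            v p = sym (+-identityˡ _)
  rawCoeff-++ ((k , q) ∷ u) v p = trans (+-congˡ (rawCoeff-++ u v p)) (sym (+-assoc _ _ _))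

  rawCoeff-neg : ∀ {n} (v : Chain n) p → rawCoeff (map (map₁ (λ k → - k)) v) p ≈ - rawCoeff v p
  rawCoeff-neg []            p = sym -0#≈0#
  rawCoeff-neg ((k , q) ∷ v) p = trans (+-cong (if-neg _) (rawCoeff-neg v p)) (⁻¹-∙-comm _ _)

  rawCoeff-−ᶜ : ∀ {n} (u v : Chain n) p → rawCoeff (u −ᶜ v) p ≈ rawCoeff u p - rawCoeff v p
  rawCoeff-−ᶜ u v p = trans (rawCoeff-++ u _ p) (+-congˡ (rawCoeff-neg v p))

  rawCoeff-concatMap : ∀ {n m} (f : Fin m → Chain n) p →
                       rawCoeff (concatMap f (allFin m)) p ≈ sum (λ a → rawCoeff (f a) p)
  rawCoeff-concatMap {m = m} f p = go (λ a → a)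
    where
    go : ∀ {k} (h : Fin k → Fin m) → rawCoeff (concatMap f (tabulate h)) p ≈ sum (λ a → rawCoeff (f (h a)) p)
    go {ℕ.zero} h = refl
    go {suc k}  h = trans (rawCoeff-++ (f (h Fin.zero)) _ p) (+-congˡ (go (h ∘ Fin.suc)))

  rawCoeff⇒≈ᶜ : ∀ {n} (u v : Chain n) → (∀ p → rawCoeff u p ≈ rawCoeff v p) → u ≈ᶜ v
  rawCoeff⇒≈ᶜ u v u≈v p with regular p
  ... | true  = u≈v p
  ... | false = refl

  ∑-neg : ∀ {m} (f : Fin m → Carrier) → sum (λ a → - f a) ≈ - sum f
  ∑-neg f = begin
    sum (λ a → - f a)      ≈⟨ sum-cong-≋ (λ a → sym (-1*x≈-x (f a))) ⟩
    sum (λ a → - 1# * f a) ≈⟨ *-distribˡ-sum (- 1#) f ⟨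
    - 1# * sum f           ≈⟨ -1*x≈-x (sum f) ⟩
    - sum f                ∎

  ∑-sub : ∀ {m} (f g : Fin m → Carrier) → sum (λ a → f a - g a) ≈ sum f - sum g
  ∑-sub f g = trans (∑-distrib-+ f (λ a → - g a)) (+-congˡ (∑-neg g))

  ∑-translate : ∀ {m} (f : Fin (suc m) → Carrier) s → sum (λ a → f (a ⊕ s)) ≈ sum f
  ∑-translate f s = sym (sum-permute f (translation s))

  ∑-sub-cancel : ∀ {m} (f g : Fin m → Carrier) → sum f ≈ sum g → sum (λ a → f a - g a) ≈ 0#
  ∑-sub-cancel f g Σf≈Σg = begin
    sum (λ a → f a - g a) ≈⟨ ∑-sub f g ⟩
    sum f - sum g         ≈⟨ +-congʳ Σf≈Σg ⟩
    sum g - sum g         ≈⟨ -‿inverseʳ (sum g) ⟩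
    0#                    ∎

  ∂-++ : ∀ {n} (u v : Chain n) → ∂ (u ++ v) ≡ ∂ u ++ ∂ v
  ∂-++ []            v = ≡.refl
  ∂-++ ((k , q) ∷ u) v = ≡.trans (cong (bd k q ++_) (∂-++ u v)) (≡.sym (++-assoc (bd k q) (∂ u) (∂ v)))

  ∂-concatMap : ∀ {n a} {A : Set a} (f : A → Chain n) (xs : List A) →
                ∂ (concatMap f xs) ≡ concatMap (∂ ∘ f) xs
  ∂-concatMap f []       = ≡.refl
  ∂-concatMap f (x ∷ xs) = ≡.trans (∂-++ (f x) _) (cong (∂ (f x) ++_) (∂-concatMap f xs))

  rawCoeff-e−e : ∀ {n} (q q′ p : List (Fin n)) → rawCoeff (e q −ᶜ e q′) p ≈ δ q p - δ q′ p
  rawCoeff-e−e q q′ p = +-congˡ (trans (+-identityʳ _) (if-neg _))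

  rawCoeff-comm : ∀ {n} (a u v : Fin n) p →
    rawCoeff (comm a u v) p ≈ δ (a ∷ a ⊕ u ∷ a ⊕ u ⊕ v ∷ []) p - δ (a ∷ a ⊕ v ∷ a ⊕ u ⊕ v ∷ []) p
  rawCoeff-comm a u v = rawCoeff-e−e (a ∷ a ⊕ u ∷ a ⊕ u ⊕ v ∷ []) (a ∷ a ⊕ v ∷ a ⊕ u ⊕ v ∷ [])

  rawCoeff-∂-e₄ : ∀ {n} (x₀ x₁ x₂ x₃ : Fin n) p →
    rawCoeff (∂ (e (x₀ ∷ x₁ ∷ x₂ ∷ x₃ ∷ []))) p ≈
      (δ (x₀ ∷ x₁ ∷ x₃ ∷ []) p - δ (x₀ ∷ x₂ ∷ x₃ ∷ []) p) + (δ (x₁ ∷ x₂ ∷ x₃ ∷ []) p - δ (x₀ ∷ x₁ ∷ x₂ ∷ []) p)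
  rawCoeff-∂-e₄ x₀ x₁ x₂ x₃ p = begin
    _                                 ≈⟨ +-congˡ (+-cong (if-neg _) (+-cong (if-neg² _) (+-congʳ (if-neg³ _)))) ⟩
    A + (- B + (C + (- D + 0#)))      ≈⟨ solve 5 (λ A nB C nD z → (A :+ (nB :+ (C :+ (nD :+ z)))) ⊜ ((C :+ nB) :+ (A :+ nD) :+ z))
                                               refl A (- B) C (- D) 0# ⟩
    (C - B) + (A - D) + 0#            ≈⟨ +-identityʳ _ ⟩
    (C - B) + (A - D)                 ∎
    where
    A = δ (x₁ ∷ x₂ ∷ x₃ ∷ []) p
    B = δ (x₀ ∷ x₂ ∷ x₃ ∷ []) p
    C = δ (x₀ ∷ x₁ ∷ x₃ ∷ []) p
    D = δ (x₀ ∷ x₁ ∷ x₂ ∷ []) p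

  -- The face e_{x z}, shared by both triangles, cancels.
  rawCoeff-∂-e₃−e₃ : ∀ {n} (x y y′ z : Fin n) p →
    rawCoeff (∂ (e (x ∷ y ∷ z ∷ []) −ᶜ e (x ∷ y′ ∷ z ∷ []))) p ≈
      (δ (y ∷ z ∷ []) p - δ (x ∷ y′ ∷ []) p) + (δ (x ∷ y ∷ []) p - δ (y′ ∷ z ∷ []) p)
  rawCoeff-∂-e₃−e₃ x y y′ z p = begin
    _                                              ≈⟨ +-congˡ (+-cong (if-neg _) (+-cong (if-neg² _)
                                                         (+-cong (if-neg _) (+-cong (if-neg² _) (+-congʳ (if-neg³ _)))))) ⟩
    A + (- M + (B + (- C + (M + (- D + 0#)))))   ≈⟨ solve 7 (λ A nM B nC M nD z →
                                                         (A :+ (nM :+ (B :+ (nC :+ (M :+ (nD :+ z))))))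
                                                           ⊜ ((A :+ nD) :+ (B :+ nC) :+ (M :+ nM :+ z)))
                                                       refl A (- M) B (- C) M (- D) 0# ⟩
    (A - D) + (B - C) + (M - M + 0#)             ≈⟨ +-congˡ (trans (+-identityʳ _) (-‿inverseʳ M)) ⟩
    (A - D) + (B - C) + 0#                        ≈⟨ +-identityʳ _ ⟩
    (A - D) + (B - C)                             ∎
    where
    A = δ (y ∷ z ∷ []) p
    M = δ (x ∷ z ∷ []) p
    B = δ (x ∷ y ∷ []) p
    C = δ (y′ ∷ z ∷ []) p
    D = δ (x ∷ y′ ∷ []) p

  coeff≈0 : ∀ {n} (u : Chain n) p → rawCoeff u p ≈ 0# → coeff u p ≈ 0#
  coeff≈0 u p u[p]≈0 with regular p
  ... | true  = u[p]≈0
  ... | false = refl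

  rawCoeff-absent : ∀ {n} {u : Chain n} {p} → All ((_≢ p) ∘ proj₂) u → rawCoeff u p ≈ 0#
  rawCoeff-absent []                           = refl
  rawCoeff-absent {u = (k , q) ∷ u} {p} (q≢p ∷ rest) with ≡-dec _≟_ q p
  ... | yes q≡p = contradiction q≡p q≢p
  ... | no  _   = trans (+-identityˡ _) (rawCoeff-absent rest)

  AllowedPath : ∀ {n} → Subset n → ℕ → List (Fin n) → Set
  AllowedPath S m q = length q ≡ suc m × Allowed S q

  AllowedChain : ∀ {n} → Subset n → ℕ → Chain n → Set c
  AllowedChain S m u = All (AllowedPath S m ∘ proj₂) u

  allowed⇒InA : ∀ {n} {S : Subset n} {m} {u : Chain n} → AllowedChain S m u → InA S m u
  allowed⇒InA {u = u} allowed p bad = coeff≈0 u p (rawCoeff-absent (All-map notAllowed allowed))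
    where
    notAllowed : ∀ {q} → AllowedPath _ _ q → q ≢ p
    notAllowed (len , al) ≡.refl = [ (λ len≢ → len≢ len) , (λ ¬al → ¬al al) ]′ bad

  module _ {m : ℕ} where
    private
      N = suc m

    rawCoeff-∂W : ∀ (u v : Fin N) p → rawCoeff (∂ (W N u v)) p ≈ 0#
    rawCoeff-∂W u v p = begin
      rawCoeff (∂ (W N u v)) p                                  ≡⟨ cong (λ w → rawCoeff w p) (∂-concatMap (λ a → comm a u v) (allFin N)) ⟩
      rawCoeff (concatMap (λ a → ∂ (comm a u v)) (allFin N)) p  ≈⟨ rawCoeff-concatMap (λ a → ∂ (comm a u v)) p ⟩
      sum (λ a → rawCoeff (∂ (comm a u v)) p)                   ≈⟨ sum-cong-≋ (λ a → rawCoeff-∂-e₃−e₃ a (a ⊕ u) (a ⊕ v) (a ⊕ u ⊕ v) p) ⟩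
      sum (λ a → (X (a ⊕ u) - X a) + (Y a - Y′ a))              ≈⟨ ∑-distrib-+ (λ a → X (a ⊕ u) - X a) (λ a → Y a - Y′ a) ⟩
      sum (λ a → X (a ⊕ u) - X a) + sum (λ a → Y a - Y′ a)    ≈⟨ +-cong (∑-sub-cancel (λ a → X (a ⊕ u)) X (∑-translate X u))
                                                                         (∑-sub-cancel Y Y′ ΣY≈ΣY′) ⟩
      0# + 0#                                                   ≈⟨ +-identityʳ 0# ⟩
      0#                                                        ∎
      where
      X Y Y′ : Fin N → Carrier
      X a  = δ (a ∷ a ⊕ v ∷ []) p
      Y a  = δ (a ∷ a ⊕ u ∷ []) p
      Y′ a = δ (a ⊕ v ∷ a ⊕ u ⊕ v ∷ []) p
      ΣY≈ΣY′ : sum Y ≈ sum Y′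
      ΣY≈ΣY′ = sym (trans (sum-cong-≋ (λ a → reflexive (cong (λ w → δ (a ⊕ v ∷ w ∷ []) p) (xy⊕z≡xz⊕y a u v))))
                          (∑-translate Y v))

    rawCoeff-W : ∀ (u v : Fin N) p →
      rawCoeff (W N u v) p ≈ sum (λ a → δ (a ∷ a ⊕ u ∷ a ⊕ u ⊕ v ∷ []) p - δ (a ∷ a ⊕ v ∷ a ⊕ u ⊕ v ∷ []) p)
    rawCoeff-W u v p = trans (rawCoeff-concatMap (λ a → comm a u v) p) (sum-cong-≋ (λ a → rawCoeff-comm a u v p))

    P-summand : Fin N → Fin N → Fin N → Chain N
    P-summand s t a = e (a ∷ a ⊕ s ∷ a ⊕ (s ⊕ t) ∷ a ⊕ (s ⊕ t) ⊕ s ∷ [])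

    rawCoeff-∂P : ∀ (s t : Fin N) p → rawCoeff (∂ (P N s t)) p ≈ rawCoeff (W N s (s ⊕ t) −ᶜ W N s t) p
    rawCoeff-∂P s t p = begin
      rawCoeff (∂ (P N s t)) p                                   ≡⟨ cong (λ w → rawCoeff w p) (∂-concatMap E (allFin N)) ⟩
      rawCoeff (concatMap (∂ ∘ E) (allFin N)) p                  ≈⟨ rawCoeff-concatMap (∂ ∘ E) p ⟩
      sum (λ a → rawCoeff (∂ (E a)) p)                           ≈⟨ sum-cong-≋ faces ⟩
      sum (λ a → Wʳ a + (D (a ⊕ s) - T a))                       ≈⟨ ∑-distrib-+ Wʳ (λ a → D (a ⊕ s) - T a) ⟩
      sum Wʳ + sum (λ a → D (a ⊕ s) - T a)                       ≈⟨ +-cong (sym (rawCoeff-concatMap (λ a → comm a s r) p))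
                                                                           (∑-sub (λ a → D (a ⊕ s)) T) ⟩
      rawCoeff (W N s r) p + (sum (λ a → D (a ⊕ s)) - sum T)     ≈⟨ +-congˡ (+-congʳ (∑-translate D s)) ⟩
      rawCoeff (W N s r) p + (sum D - sum T)                     ≈⟨ +-congˡ (⁻¹-anti-homo‿- (sum T) (sum D)) ⟨
      rawCoeff (W N s r) p - (sum T - sum D)                     ≈⟨ +-congˡ (-‿cong (trans (rawCoeff-W s t p) (∑-sub T D))) ⟨
      rawCoeff (W N s r) p - rawCoeff (W N s t) p                ≈⟨ rawCoeff-−ᶜ (W N s r) (W N s t) p ⟨
      rawCoeff (W N s r −ᶜ W N s t) p                            ∎
      where
      r = s ⊕ t
      E = P-summand s t
      Wʳ D T : Fin N → Carrier
      Wʳ a = rawCoeff (comm a s r) p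
      D a  = δ (a ∷ a ⊕ t ∷ a ⊕ s ⊕ t ∷ []) p
      T a  = δ (a ∷ a ⊕ s ∷ a ⊕ s ⊕ t ∷ []) p
      faces : ∀ a → rawCoeff (∂ (E a)) p ≈ Wʳ a + (D (a ⊕ s) - T a)
      faces a = trans (rawCoeff-∂-e₄ a (a ⊕ s) (a ⊕ r) (a ⊕ r ⊕ s) p) (+-cong
        (trans (reflexive (cong (λ w → δ (a ∷ a ⊕ s ∷ w ∷ []) p - δ (a ∷ a ⊕ r ∷ w ∷ []) p) (xy⊕z≡xz⊕y a r s)))
               (sym (rawCoeff-comm a s r p)))
        (reflexive (cong₂ (λ w w′ → δ (a ⊕ s ∷ w ∷ w′ ∷ []) p - δ (a ∷ a ⊕ s ∷ w ∷ []) p) a⊕r≡a⊕s⊕t a⊕r⊕s≡a⊕s⊕s⊕t)))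
        where
        a⊕r≡a⊕s⊕t : a ⊕ r ≡ a ⊕ s ⊕ t
        a⊕r≡a⊕s⊕t = ≡.sym (⊕-assoc a s t)
        a⊕r⊕s≡a⊕s⊕s⊕t : a ⊕ r ⊕ s ≡ a ⊕ s ⊕ s ⊕ t
        a⊕r⊕s≡a⊕s⊕s⊕t = ≡.trans (cong (_⊕ s) a⊕r≡a⊕s⊕t) (xy⊕z≡xz⊕y (a ⊕ s) t s)

    ∂W≈ᶜ0 : ∀ (u v : Fin N) → ∂ (W N u v) ≈ᶜ zeroᶜ
    ∂W≈ᶜ0 u v = rawCoeff⇒≈ᶜ (∂ (W N u v)) zeroᶜ (rawCoeff-∂W u v)

    ∂P≈ᶜW−W : ∀ (s t : Fin N) → ∂ (P N s t) ≈ᶜ W N s (s ⊕ t) −ᶜ W N s t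
    ∂P≈ᶜW−W s t = rawCoeff⇒≈ᶜ (∂ (P N s t)) (W N s (s ⊕ t) −ᶜ W N s t) (rawCoeff-∂P s t)

    module _ {S : Subset N} where
      W-allowed : ∀ {u v} → u ∈ S → v ∈ S → AllowedChain S 2 (W N u v)
      W-allowed {u} {v} u∈S v∈S = All-concatMap (λ a → comm a u v) (allFin N) λ a →
        (≡.refl , (u , u∈S , ≡.refl) , (v , v∈S , ≡.refl) , tt) ∷
        (≡.refl , (v , v∈S , ≡.refl) , (u , u∈S , xy⊕z≡xz⊕y a u v) , tt) ∷ []

      P-allowed : ∀ {s t} → s ∈ S → t ∈ S → AllowedChain S 3 (P N s t)
      P-allowed {s} {t} s∈S t∈S = All-concatMap (P-summand s t) (allFin N) λ a →
        (≡.refl , (s , s∈S , ≡.refl) , (t , t∈S , ≡.sym (⊕-assoc a s t)) , (s , s∈S , ≡.refl) , tt) ∷ []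

      ∂P-allowed : ∀ {s t} → s ∈ S → t ∈ S → s ⊕ t ∈ S → AllowedChain S 2 (∂ (P N s t))
      ∂P-allowed {s} {t} s∈S t∈S r∈S = ≡.subst (AllowedChain S 2) (≡.sym (∂-concatMap (P-summand s t) (allFin N)))
          (All-concatMap (∂ ∘ P-summand s t) (allFin N) λ a →
        (≡.refl , (t , t∈S , ≡.sym (⊕-assoc a s t)) , (s , s∈S , ≡.refl) , tt) ∷
        (≡.refl , (s ⊕ t , r∈S , ≡.refl) , (s , s∈S , ≡.refl) , tt) ∷
        (≡.refl , (s , s∈S , ≡.refl) , (s ⊕ t , r∈S , xy⊕z≡xz⊕y a (s ⊕ t) s) , tt) ∷
        (≡.refl , (s , s∈S , ≡.refl) , (t , t∈S , ≡.sym (⊕-assoc a s t)) , tt) ∷ [])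

      W∈Ω₂ : ∀ {u v} → u ∈ S → v ∈ S → InΩ S 2 (W N u v)
      W∈Ω₂ {u} {v} u∈S v∈S = allowed⇒InA (W-allowed u∈S v∈S) , λ p _ → coeff≈0 (∂ (W N u v)) p (rawCoeff-∂W u v p)

      P∈Ω₃ : ∀ {s t} → s ∈ S → t ∈ S → s ⊕ t ∈ S → InΩ S 3 (P N s t)
      P∈Ω₃ s∈S t∈S r∈S = allowed⇒InA (P-allowed s∈S t∈S) , allowed⇒InA (∂P-allowed s∈S t∈S r∈S)

proposition3p8 : ∀ {c ℓ : Level} (K : CharZeroField c ℓ) → let open Chains K in
    (n : ℕ) → 3 ≤ n → (S : Subset n) → (∀ x → x ∈ S → toℕ x ≢ 0) → 2 ≤ ∣ S ∣ →
    (s t r : Fin n) → s ∈ S → t ∈ S → r ∈ S → r ≡ s ⊕ t →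
    InΩ S 3 (P n s t) × ∂ (P n s t) ≈ᶜ W n s r −ᶜ W n s t × SameClass S 2 (W n s r) (W n s t)
proposition3p8 K (suc m) _ S _ _ s t .(s ⊕ t) s∈S t∈S r∈S ≡.refl =
  P∈Ω , ∂P≈ᶜW−W s t , W∈Ω₂ s∈S r∈S , W∈Ω₂ s∈S t∈S , ∂W≈ᶜ0 s (s ⊕ t) , ∂W≈ᶜ0 s t , P (suc m) s t , P∈Ω , ∂P≈ᶜW−W s t
  where
  open Chains K using (P; InΩ)
  open PathChains K
  P∈Ω : InΩ S 3 (P (suc m) s t)
  P∈Ω = P∈Ω₃ s∈S t∈S r∈S
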